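{- Let $k,m,n$ be non-negative integers such that $n \ge k \ge 5$, $m \ge b_k$ and $2^m \ge m - b_k + \nu_2(k!)$. If the function $j\mapsto \nu_2(S(j,k))$ is non-constant on $[n]_{2^m}$, then $S(j,k) \equiv 0 \pmod{2^{m-b_k}}$ for every $j \in [n]_{2^m}$.
   Context: $S(n,k)$ denotes the Stirling number of the second kind. $\nu_2(z)$ is the exponent of the largest power of $2$ dividing the positive integer $z$. $b_k = \lceil \log_2 k\rceil - 2$. For $n,t\in\mathbb{N}$, $[n]_t = \{ j \in \mathbb{N} : j \ge \max\{n,t\},\ j \equiv n \pmod t\}$. A function is constant on a set if its image of that set is a singleton. -}

module Defs where

open import Data.Nat using (ℕ; zero; suc; _+_; _*_; _∸_; _^_; _≤_; _≥_)
open import Data.Nat.DivMod using (_%_; _/_)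
open import Data.Nat.Logarithm using (⌈log₂_⌉)
open import Data.Nat.Divisibility using (_∣_)
open import Data.Product using (_×_)
open import Relation.Binary.PropositionalEquality using (_≡_)

S : ℕ → ℕ → ℕ
S zero    zero    = 1
S zero    (suc k) = 0
S (suc n) zero    = 0
S (suc n) (suc k) = suc k * S n (suc k) + S n k

-- 2-adic valuation with fuel; with fuel ≥ z the result is exact for z ≥ 1.
ν₂-go : ℕ → ℕ → ℕ
ν₂-go zero       z = 0
ν₂-go (suc fuel) zero = 0
ν₂-go (suc fuel) (suc z) with (suc z) % 2
... | zero  = suc (ν₂-go fuel ((suc z) / 2))
... | suc _ = 0

-- ν₂ z = exponent of the largest power of 2 dividing z (for z ≥ 1; ν₂ 0 = 0 by convention)
ν₂ : ℕ → ℕ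
ν₂ z = ν₂-go z z

b : ℕ → ℕ
b k = ⌈log₂ k ⌉ ∸ 2

fact : ℕ → ℕ
fact zero    = 1
fact (suc n) = suc n * fact n

-- j ∈ [n]_t  :  j ≥ max(n,t) and j ≡ n (mod t)   (t ≥ 1)
InClass : ℕ → ℕ → ℕ → Set
InClass n t j = (j ≥ n) × (j ≥ t) × (j % suc (t ∸ 1) ≡ n % suc (t ∸ 1))

-- By the recurrence, S(k + s, k) = h_s(k, …, 2, 1), the complete homogeneous symmetric
-- polynomial, and by symmetry its arguments may be listed as the evens 2E, …, 2 followed
-- by the odds 2q+1, …, 3, 1.  Put T = 2^m and N = m − b_k.  For the odd part, h_w is
-- congruent modulo 2^N to h_{w−T} (read as 0 when w < T) in all degrees w ≥ T − q: the
-- recurrence h(x ∷ X, w+1) = x·h(x ∷ X, w) + h(X, w+1) propagates this from one anchor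
-- degree per odd element, and the anchors come from 2^j h_s(2j+1, …, 3, 1) =
-- Σ_t C(s+j, t) 2^t S(t, j) at s + j = T together with ν₂ C(2^m, t) ≥ m − ν₂ t.  Each even
-- element costs one degree of that range but contributes a factor 2, and
-- 2^m ≥ N + ν₂(k!) ≥ N + E makes the range contain every j ≥ max(k, T).  So S(·, k) is
-- 2^m-periodic modulo 2^N on [n]_{2^m}; were some S(j, k) not divisible by 2^N, every
-- member of the class would share its valuation ν₂ S(j, k) < N.

module Submission where

open import Data.List.Base using (List; []; _∷_; _++_; applyDownFrom)
open import Data.List.Relation.Binary.Permutation.Propositional as ↭ using (_↭_)
open import Data.List.Relation.Binary.Permutation.Propositional.Properties using (shift)
open import Data.Nat.Base
open import Data.Nat.Combinatorics using (_C_; nCk+nC[k+1]≡[n+1]C[k+1]; nCn≡1; nC1≡n; k>n⇒nCk≡0)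
open import Data.Nat.Divisibility as ℕ using (_∣_; divides)
open import Data.Nat.DivMod using (m≡m%n+[m/n]*n; /-monoˡ-≤)
open import Data.Nat.Induction using (<-rec)
open import Data.Nat.Logarithm
  using (⌈log₂_⌉; ⌈log₂⌉-mono-≤; ⌈log₂⌈n/2⌉⌉≡⌈log₂n⌉∸1; ⌈log₂2^n⌉≡n)
open import Data.Nat.Primality using (euclidsLemma; prime[2])
open import Data.Nat.Properties
import Data.Nat.Tactic.RingSolver as ℕ-Solver
open import Algebra.Properties.CommutativeSemigroup +-commutativeSemigroup
  using () renaming (interchange to +-+-interchange)
import Data.Integer.Base as ℤ
import Data.Integer.Divisibility.Signed as ℤ
import Data.Integer.Properties as ℤ
import Data.Integer.Tactic.RingSolver as ℤ-Solver
open import Data.Product.Base using (Σ; ∃-syntax; _×_; _,_)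
open import Data.Sum.Base using (_⊎_; inj₁; inj₂)
open import Function.Base using (_∘_)
open import Relation.Binary.PropositionalEquality
open import Relation.Nullary using (¬_; contradiction; yes; no)
open import Relation.Nullary.Decidable using (decidable-stable)

open import Defs

2*n≡n+n : ∀ n → 2 * n ≡ n + n
2*n≡n+n n = cong (n +_) (+-identityʳ n)

n<2*n : ∀ {n} → 1 ≤ n → n < 2 * n
n<2*n {n} 1≤n = subst (n <_) (sym (2*n≡n+n n)) (m<m+n n 1≤n)

2^-mono-∣ : ∀ {a b} → a ≤ b → 2 ^ a ∣ 2 ^ b
2^-mono-∣ {a} {b} a≤b = divides (2 ^ (b ∸ a)) (begin
  2 ^ b               ≡⟨ cong (2 ^_) (m+[n∸m]≡n a≤b) ⟨
  2 ^ (a + (b ∸ a))   ≡⟨ ^-distribˡ-+-* 2 a (b ∸ a) ⟩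
  2 ^ a * 2 ^ (b ∸ a) ≡⟨ *-comm (2 ^ a) _ ⟩
  2 ^ (b ∸ a) * 2 ^ a ∎)
  where open ≡-Reasoning

2^e∣odd*n⇒2^e∣n : ∀ {u n} e → ¬ 2 ∣ u → 2 ^ e ∣ u * n → 2 ^ e ∣ n
2^e∣odd*n⇒2^e∣n         zero    _   _ = ℕ.1∣ _
2^e∣odd*n⇒2^e∣n {u} {n} (suc e) 2∤u 2^[1+e]∣un
  with euclidsLemma u n prime[2] (ℕ.∣-trans (ℕ.∣m⇒∣m*n (2 ^ e) ℕ.∣-refl) 2^[1+e]∣un)
... | inj₁ 2∣u              = contradiction 2∣u 2∤u
... | inj₂ (divides c refl) = subst (_∣ c * 2) (*-comm (2 ^ e) 2) (ℕ.*-monoˡ-∣ 2 2^e∣c)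
  where
  reorder : ∀ u c → u * (c * 2) ≡ 2 * (u * c)
  reorder = ℕ-Solver.solve-∀
  2^e∣c : 2 ^ e ∣ c
  2^e∣c = 2^e∣odd*n⇒2^e∣n e 2∤u (ℕ.*-cancelˡ-∣ 2 (subst (2 * 2 ^ e ∣_) (reorder u c) 2^[1+e]∣un))

halve : ∀ {n} → n % 2 ≡ 0 → n ≡ 2 * (n / 2)
halve {n} eq = trans (m≡m%n+[m/n]*n n 2) (trans (cong (_+ n / 2 * 2) eq) (*-comm (n / 2) 2))

2^ν₂-go∣ : ∀ fuel z → 2 ^ ν₂-go fuel z ∣ z
2^ν₂-go∣ zero    z       = ℕ.1∣ z
2^ν₂-go∣ (suc f) zero    = ℕ.1∣ 0
2^ν₂-go∣ (suc f) (suc z) with suc z % 2 in eq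
... | zero  = subst (2 * 2 ^ ν₂-go f (suc z / 2) ∣_) (sym (halve eq))
                (ℕ.*-monoʳ-∣ 2 (2^ν₂-go∣ f (suc z / 2)))
... | suc _ = ℕ.1∣ _

ν₂-go-maximal : ∀ {fuel z} a → 1 ≤ z → z ≤ fuel → 2 ^ a ∣ z → a ≤ ν₂-go fuel z
ν₂-go-maximal {suc f} {suc z} a 1≤z z≤f 2^a∣z with suc z % 2 in eq
ν₂-go-maximal zero _ _ _ | _ = z≤n
ν₂-go-maximal {suc f} {suc z} (suc a) _ z≤f 2^a∣z | zero =
  s≤s (ν₂-go-maximal a 1≤y y≤f (ℕ.*-cancelˡ-∣ 2 (subst (2 * 2 ^ a ∣_) z≡2y 2^a∣z)))
  where
  z≡2y : suc z ≡ 2 * (suc z / 2)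
  z≡2y = halve eq
  1≤y : 1 ≤ suc z / 2
  1≤y = n≢0⇒n>0 (λ y≡0 → 1+n≢0 (trans z≡2y (cong (2 *_) y≡0)))
  y≤f : suc z / 2 ≤ f
  y≤f = s≤s⁻¹ (≤-trans (subst (suc z / 2 <_) (sym z≡2y) (n<2*n 1≤y)) z≤f)
ν₂-go-maximal {suc f} {suc z} (suc a) _ _ 2^a∣z | suc _ = contradiction (trans (sym eq) z%2≡0) 1+n≢0
  where
  z%2≡0 : suc z % 2 ≡ 0
  z%2≡0 = ℕ.n∣m⇒m%n≡0 (suc z) 2 (ℕ.∣-trans (ℕ.∣m⇒∣m*n (2 ^ a) ℕ.∣-refl) 2^a∣z)

2^ν₂∣ : ∀ z → 2 ^ ν₂ z ∣ z
2^ν₂∣ z = 2^ν₂-go∣ z z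

ν₂-maximal : ∀ {z} a → 1 ≤ z → 2 ^ a ∣ z → a ≤ ν₂ z
ν₂-maximal a 1≤z = ν₂-go-maximal a 1≤z ≤-refl

odd-part : ∀ {t} → 1 ≤ t → ∃[ u ] t ≡ u * 2 ^ ν₂ t × ¬ 2 ∣ u
odd-part {t} 1≤t with 2^ν₂∣ t
... | divides u t≡u*2^v = u , t≡u*2^v , λ 2∣u →
  <-irrefl refl (ν₂-maximal (suc (ν₂ t)) 1≤t
    (subst (2 ^ suc (ν₂ t) ∣_) (sym t≡u*2^v) (ℕ.*-monoˡ-∣ (2 ^ ν₂ t) 2∣u)))

module _ where

  -- Opened only here: unqualified, ℤ's +_ makes sections such as (a +_) of ℕ ambiguous.
  open import Data.Integer.Base using (+_)

  infix 4 _≡_[mod2^_]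

  record _≡_[mod2^_] (a b e : ℕ) : Set where
    constructor mod
    field 2^e∣a-b : + (2 ^ e) ℤ.∣ + a ℤ.- + b

  pos-*-distribˡ-− : ∀ c a b → + c ℤ.* (+ a ℤ.- + b) ≡ + (c * a) ℤ.- + (c * b)
  pos-*-distribˡ-− c a b =
    trans (distrib (+ c) (+ a) (+ b)) (sym (cong₂ ℤ._-_ (ℤ.pos-* c a) (ℤ.pos-* c b)))
    where
    distrib : ∀ z x y → z ℤ.* (x ℤ.- y) ≡ z ℤ.* x ℤ.- z ℤ.* y
    distrib = ℤ-Solver.solve-∀

  mod-refl : ∀ {e} a → a ≡ a [mod2^ e ]
  mod-refl a = mod (subst (_ ℤ.∣_) (sym (ℤ.+-inverseʳ (+ a))) (ℤ.∣ᵤ⇒∣ (ℕ._∣0 _)))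

  mod-reflexive : ∀ {e a b} → a ≡ b → a ≡ b [mod2^ e ]
  mod-reflexive {b = b} refl = mod-refl b

  mod-0 : ∀ a b → a ≡ b [mod2^ 0 ]
  mod-0 a b = mod (ℤ.∣ᵤ⇒∣ (ℕ.1∣ _))

  mod-weaken : ∀ {d e a b} → d ≤ e → a ≡ b [mod2^ e ] → a ≡ b [mod2^ d ]
  mod-weaken d≤e (mod p) = mod (ℤ.∣-trans (ℤ.∣ᵤ⇒∣ (2^-mono-∣ d≤e)) p)

  module _ {e : ℕ} where

    mod-sym : ∀ {a b} → a ≡ b [mod2^ e ] → b ≡ a [mod2^ e ]
    mod-sym {a} {b} (mod p) = mod (subst (_ ℤ.∣_) (negate (+ a) (+ b)) (ℤ.∣m⇒∣-m p))
      where
      negate : ∀ x y → ℤ.- (x ℤ.- y) ≡ y ℤ.- x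
      negate = ℤ-Solver.solve-∀

    mod-trans : ∀ {a b c} → a ≡ b [mod2^ e ] → b ≡ c [mod2^ e ] → a ≡ c [mod2^ e ]
    mod-trans {a} {b} {c} (mod p) (mod q) =
      mod (subst (_ ℤ.∣_) (telescope (+ a) (+ b) (+ c)) (ℤ.∣m∣n⇒∣m+n p q))
      where
      telescope : ∀ x y z → (x ℤ.- y) ℤ.+ (y ℤ.- z) ≡ x ℤ.- z
      telescope = ℤ-Solver.solve-∀

    mod-+ : ∀ {a a′ b b′} → a ≡ a′ [mod2^ e ] → b ≡ b′ [mod2^ e ] → a + b ≡ a′ + b′ [mod2^ e ]
    mod-+ {a} {a′} {b} {b′} (mod p) (mod q) = mod (subst (_ ℤ.∣_) eq (ℤ.∣m∣n⇒∣m+n p q))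
      where
      regroup : ∀ x x′ y y′ → (x ℤ.- x′) ℤ.+ (y ℤ.- y′) ≡ (x ℤ.+ y) ℤ.- (x′ ℤ.+ y′)
      regroup = ℤ-Solver.solve-∀
      eq : (+ a ℤ.- + a′) ℤ.+ (+ b ℤ.- + b′) ≡ + (a + b) ℤ.- + (a′ + b′)
      eq = trans (regroup (+ a) (+ a′) (+ b) (+ b′))
                 (sym (cong₂ ℤ._-_ (ℤ.pos-+ a b) (ℤ.pos-+ a′ b′)))

    mod-*ˡ : ∀ c {a b} → a ≡ b [mod2^ e ] → c * a ≡ c * b [mod2^ e ]
    mod-*ˡ c {a} {b} (mod p) = mod (subst (_ ℤ.∣_) (pos-*-distribˡ-− c a b) (ℤ.∣n⇒∣m*n (+ c) p))

    mod-even-*ˡ : ∀ y {a b} → a ≡ b [mod2^ e ] → 2 * y * a ≡ 2 * y * b [mod2^ suc e ]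
    mod-even-*ˡ y {a} {b} p = let mod q = mod-*ˡ y p in
      mod (subst₂ ℤ._∣_ (sym (ℤ.pos-* 2 (2 ^ e))) eq (ℤ.*-monoʳ-∣ (+ 2) q))
      where
      eq : + 2 ℤ.* (+ (y * a) ℤ.- + (y * b)) ≡ + (2 * y * a) ℤ.- + (2 * y * b)
      eq = trans (pos-*-distribˡ-− 2 (y * a) (y * b))
                 (sym (cong₂ (λ u v → + u ℤ.- + v) (*-assoc 2 y a) (*-assoc 2 y b)))

    mod-∣ : ∀ {a b} → a ≡ b [mod2^ e ] → 2 ^ e ∣ b → 2 ^ e ∣ a
    mod-∣ {a} {b} (mod p) 2^e∣b =
      ℤ.∣⇒∣ᵤ (subst (_ ℤ.∣_) (cancel (+ a) (+ b)) (ℤ.∣m∣n⇒∣m+n p (ℤ.∣ᵤ⇒∣ 2^e∣b)))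
      where
      cancel : ∀ x y → (x ℤ.- y) ℤ.+ y ≡ x
      cancel = ℤ-Solver.solve-∀

    ∣⇒mod-0 : ∀ {a} → 2 ^ e ∣ a → a ≡ 0 [mod2^ e ]
    ∣⇒mod-0 {a} 2^e∣a = mod (subst (+ (2 ^ e) ℤ.∣_) (sym (ℤ.+-identityʳ (+ a))) (ℤ.∣ᵤ⇒∣ 2^e∣a))

ν₂-≤-of-≡mod : ∀ {N x y} → 1 ≤ x → ¬ 2 ^ N ∣ y → x ≡ y [mod2^ N ] → ν₂ y ≤ ν₂ x
ν₂-≤-of-≡mod {N} {x} {y} 1≤x 2^N∤y x≡y with ν₂ y ≤? N
... | yes v≤N = ν₂-maximal (ν₂ y) 1≤x (mod-∣ (mod-weaken v≤N x≡y) (2^ν₂∣ y))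
... | no  v≰N = contradiction (ℕ.∣-trans (2^-mono-∣ (<⇒≤ (≰⇒> v≰N))) (2^ν₂∣ y)) 2^N∤y

ν₂-cong-≡mod : ∀ {N x y} → 1 ≤ x → 1 ≤ y → ¬ 2 ^ N ∣ y → x ≡ y [mod2^ N ] → ν₂ x ≡ ν₂ y
ν₂-cong-≡mod 1≤x 1≤y 2^N∤y x≡y = ≤-antisym
  (ν₂-≤-of-≡mod 1≤y (2^N∤y ∘ mod-∣ (mod-sym x≡y)) (mod-sym x≡y))
  (ν₂-≤-of-≡mod 1≤x 2^N∤y x≡y)

-- h xs s is the complete homogeneous symmetric polynomial of degree s in the entries of xs.
h : List ℕ → ℕ → ℕ
h []       zero    = 1
h []       (suc s) = 0
h (x ∷ xs) zero    = 1
h (x ∷ xs) (suc s) = x * h (x ∷ xs) s + h xs (suc s)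

h-0 : ∀ xs → h xs 0 ≡ 1
h-0 []      = refl
h-0 (_ ∷ _) = refl

h-[1] : ∀ w → h (1 ∷ []) w ≡ 1
h-[1] zero    = refl
h-[1] (suc w) = trans (+-identityʳ (1 * h (1 ∷ []) w)) (trans (*-identityˡ _) (h-[1] w))

h-pos : ∀ {x} xs s → 1 ≤ x → 1 ≤ h (x ∷ xs) s
h-pos xs zero    _   = s≤s z≤n
h-pos xs (suc s) 1≤x = ≤-trans (*-mono-≤ 1≤x (h-pos xs s 1≤x)) (m≤m+n _ _)

h-∷-cong : ∀ x {xs ys} → (∀ s → h xs s ≡ h ys s) → ∀ s → h (x ∷ xs) s ≡ h (x ∷ ys) s
h-∷-cong x eq zero    = refl
h-∷-cong x eq (suc s) = cong₂ _+_ (cong (x *_) (h-∷-cong x eq s)) (eq (suc s))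

module _ (x y : ℕ) (zs : List ℕ) where

  private
    hxy = h (x ∷ y ∷ zs)
    hyx = h (y ∷ x ∷ zs)
    hx  = h (x ∷ zs)
    hy  = h (y ∷ zs)
    hz  = h zs

  mutual
    h-swap : ∀ s → hxy s ≡ hyx s
    h-swap zero    = refl
    h-swap (suc s) = begin
      x * hxy s + (y * hy s + hz (suc s))   ≡⟨ +-assoc (x * hxy s) _ _ ⟨
      x * hxy s + y * hy s + hz (suc s)     ≡⟨ cong (_+ hz (suc s)) (h-swap-step s) ⟩
      y * hxy s + x * hx s + hz (suc s)     ≡⟨ +-assoc (y * hxy s) _ _ ⟩
      y * hxy s + (x * hx s + hz (suc s))   ≡⟨ cong (λ u → y * u + (x * hx s + hz (suc s))) (h-swap s) ⟩
      y * hyx s + (x * hx s + hz (suc s))   ∎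
      where open ≡-Reasoning

    h-swap-step : ∀ s → x * hxy s + y * hy s ≡ y * hxy s + x * hx s
    h-swap-step zero    = +-comm (x * 1) (y * 1)
    h-swap-step (suc s) = begin
      x * hxy (suc s) + y * hy (suc s)
        ≡⟨ cong (λ u → x * u + y * hy (suc s)) (h-swap (suc s)) ⟩
      x * (y * hyx s + (x * hx s + hz (suc s))) + y * (y * hy s + hz (suc s))
        ≡⟨ cong (λ u → x * (y * u + (x * hx s + hz (suc s))) + y * (y * hy s + hz (suc s))) (h-swap s) ⟨
      x * (y * hxy s + (x * hx s + hz (suc s))) + y * (y * hy s + hz (suc s))
        ≡⟨ exchange x y (hxy s) (hx s) (hy s) (hz (suc s)) ⟩
      y * hxy (suc s) + x * hx (suc s) ∎
      where
      open ≡-Reasoning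
      exchange : ∀ x y a b c d →
        x * (y * a + (x * b + d)) + y * (y * c + d) ≡ y * (x * a + (y * c + d)) + x * (x * b + d)
      exchange = ℕ-Solver.solve-∀

h-↭ : ∀ {xs ys} → xs ↭ ys → ∀ s → h xs s ≡ h ys s
h-↭ ↭.refl                        s = refl
h-↭ (↭.prep x p)                     = h-∷-cong x (h-↭ p)
h-↭ {x ∷ y ∷ xs} (↭.swap x y p)   s = trans (h-swap x y xs s) (h-∷-cong y (h-∷-cong x (h-↭ p)) s)
h-↭ (↭.trans p q)                 s = trans (h-↭ p s) (h-↭ q s)

S-< : ∀ {n k} → n < k → S n k ≡ 0
S-< {zero}  {suc k} _         = refl
S-< {suc n} {suc k} (s≤s n<k) =
  cong₂ _+_ (trans (cong (suc k *_) (S-< (m<n⇒m<1+n n<k))) (*-zeroʳ (suc k))) (S-< n<k)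

S-diag : ∀ k → S k k ≡ 1
S-diag zero    = refl
S-diag (suc k) = begin
  suc k * S k (suc k) + S k k   ≡⟨ cong (λ u → suc k * u + S k k) (S-< (n<1+n k)) ⟩
  suc k * 0 + S k k             ≡⟨ cong (_+ S k k) (*-zeroʳ (suc k)) ⟩
  S k k                         ≡⟨ S-diag k ⟩
  1                             ∎
  where open ≡-Reasoning

S-as-h : ∀ k s → S (k + s) k ≡ h (applyDownFrom suc k) s
S-as-h zero    zero    = refl
S-as-h zero    (suc s) = refl
S-as-h (suc k) zero    = trans (cong (λ n → S n (suc k)) (+-identityʳ (suc k))) (S-diag (suc k))
S-as-h (suc k) (suc s) = begin
  S (suc k + suc s) (suc k)
    ≡⟨ cong (λ n → S (suc n) (suc k)) (+-suc k s) ⟩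
  suc k * S (suc k + s) (suc k) + S (suc k + s) k
    ≡⟨ cong (λ n → suc k * S (suc k + s) (suc k) + S n k) (+-suc k s) ⟨
  suc k * S (suc k + s) (suc k) + S (k + suc s) k
    ≡⟨ cong₂ (λ u v → suc k * u + v) (S-as-h (suc k) s) (S-as-h k (suc s)) ⟩
  suc k * h (applyDownFrom suc (suc k)) s + h (applyDownFrom suc k) (suc s) ∎
  where open ≡-Reasoning

S-pos : ∀ {k n} → 1 ≤ k → k ≤ n → 1 ≤ S n k
S-pos {suc k} {n} _ k≤n = subst (1 ≤_) h≡S (h-pos (applyDownFrom suc k) (n ∸ suc k) (s≤s z≤n))
  where
  h≡S : h (applyDownFrom suc (suc k)) (n ∸ suc k) ≡ S n (suc k)
  h≡S = trans (sym (S-as-h (suc k) (n ∸ suc k))) (cong (λ n → S n (suc k)) (m+[n∸m]≡n k≤n))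

odds : ℕ → List ℕ
odds zero    = 1 ∷ []
odds (suc j) = suc (2 * suc j) ∷ odds j

evens : ℕ → List ℕ
evens zero    = []
evens (suc q) = 2 * suc q ∷ evens q

mutual
  downFrom-odd↭ : ∀ q → applyDownFrom suc (suc (2 * q)) ↭ evens q ++ odds q
  downFrom-odd↭ zero    = ↭.refl
  downFrom-odd↭ (suc q) =
    ↭.trans (↭.prep (suc (2 * suc q)) (downFrom-even↭ q)) (↭.↭-sym (shift _ (evens (suc q)) (odds q)))

  downFrom-even↭ : ∀ q → applyDownFrom suc (2 * suc q) ↭ evens (suc q) ++ odds q
  downFrom-even↭ q = subst (λ n → applyDownFrom suc n ↭ n ∷ evens q ++ odds q) (sym (*-suc 2 q))
                       (↭.prep (2 + 2 * q) (downFrom-odd↭ q))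

even⊎odd : ∀ n → ∃[ q ] (n ≡ 2 * q ⊎ n ≡ suc (2 * q))
even⊎odd zero    = 0 , inj₁ refl
even⊎odd (suc n) with even⊎odd n
... | q , inj₁ n≡2q   = q , inj₂ (cong suc n≡2q)
... | q , inj₂ n≡1+2q = suc q , inj₁ (trans (cong suc n≡1+2q) (sym (*-suc 2 q)))

halves : ∀ k → 1 ≤ k → ∃[ E ] ∃[ q ]
  k ≡ E + suc q × q ≤ E × E ≤ suc q × applyDownFrom suc k ↭ evens E ++ odds q
halves k 1≤k with even⊎odd k
... | zero  , inj₁ refl = contradiction 1≤k (λ ())
... | suc q , inj₁ refl = suc q , q , 2*n≡n+n (suc q) , n≤1+n q , ≤-refl , downFrom-even↭ q
... | q     , inj₂ refl = q , q , trans (cong suc (2*n≡n+n q)) (sym (+-suc q q)) , ≤-refl , n≤1+n q ,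
                          downFrom-odd↭ q

hShift : ℕ → List ℕ → ℕ → ℕ
hShift zero    xs w       = h xs w
hShift (suc T) xs zero    = 0
hShift (suc T) xs (suc w) = hShift T xs w

hShift-+ : ∀ T xs d → hShift T xs (T + d) ≡ h xs d
hShift-+ zero    xs d = refl
hShift-+ (suc T) xs d = hShift-+ T xs d

hShift-< : ∀ {T w} xs → w < T → hShift T xs w ≡ 0
hShift-< {suc T} {zero}  xs _         = refl
hShift-< {suc T} {suc w} xs (s≤s w<T) = hShift-< xs w<T

hShift-0 : ∀ T xs ys → hShift T xs 0 ≡ hShift T ys 0
hShift-0 zero    xs ys = trans (h-0 xs) (sym (h-0 ys))
hShift-0 (suc T) xs ys = refl

hShift-∷ : ∀ T x xs w → hShift T (x ∷ xs) (suc w) ≡ x * hShift T (x ∷ xs) w + hShift T xs (suc w)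
hShift-∷ zero    x xs w       = refl
hShift-∷ (suc T) x xs zero    = trans (hShift-0 T (x ∷ xs) xs) (cong (_+ hShift T xs 0) (sym (*-zeroʳ x)))
hShift-∷ (suc T) x xs (suc w) = hShift-∷ T x xs w

from-≤ : ∀ (P : ℕ → Set) {a} → (∀ d → P (a + d)) → ∀ {w} → a ≤ w → P w
from-≤ P {a} P[a+_] a≤w = subst P (m+[n∸m]≡n a≤w) (P[a+_] _)

-- Below degree T this says 2^e ∣ h xs w; from degree T on, h xs w ≡ h xs (w ∸ T).
ShiftCongruent : ℕ → ℕ → List ℕ → ℕ → Set
ShiftCongruent e T xs β = ∀ w → T ≤ w + β → h xs w ≡ hShift T xs w [mod2^ e ]

GradedShiftCongruent : ℕ → ℕ → List ℕ → ℕ → Set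
GradedShiftCongruent N T xs β =
  ∀ e → e ≤ N → ∀ w → e + T ≤ w + β → h xs w ≡ hShift T xs w [mod2^ e ]

shiftCongruent-[1] : ∀ e T → ShiftCongruent e T (1 ∷ []) 0
shiftCongruent-[1] e T w T≤w+0 = from-≤ P 1≡1 (subst (T ≤_) (+-identityʳ w) T≤w+0)
  where
  P : ℕ → Set
  P w = h (1 ∷ []) w ≡ hShift T (1 ∷ []) w [mod2^ e ]
  1≡1 : ∀ d → P (T + d)
  1≡1 d = mod-reflexive (trans (h-[1] (T + d)) (sym (trans (hShift-+ T (1 ∷ []) d) (h-[1] d))))

shiftCongruent-∷ : ∀ {e T x xs j} → suc j ≤ T → 2 ^ e ∣ h (x ∷ xs) (T ∸ suc j) →
                   ShiftCongruent e T xs j → ShiftCongruent e T (x ∷ xs) (suc j)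
shiftCongruent-∷ {e} {T} {x} {xs} {j} j<T anchor xs≡ w T≤w+1+j = from-≤ P above w₀≤w
  where
  w₀ = T ∸ suc j
  w₀+1+j≡T : w₀ + suc j ≡ T
  w₀+1+j≡T = m∸n+n≡m j<T
  w₀≤w : w₀ ≤ w
  w₀≤w = m≤n+o⇒m∸n≤o T (suc j) (subst (T ≤_) (+-comm w (suc j)) T≤w+1+j)
  P : ℕ → Set
  P w = h (x ∷ xs) w ≡ hShift T (x ∷ xs) w [mod2^ e ]
  above : ∀ d → P (w₀ + d)
  above zero    = subst P (sym (+-identityʳ w₀))
    (subst (λ v → h (x ∷ xs) w₀ ≡ v [mod2^ e ]) (sym (hShift-< (x ∷ xs) w₀<T)) (∣⇒mod-0 anchor))
    where
    w₀<T : w₀ < T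
    w₀<T = subst (w₀ <_) w₀+1+j≡T (m<m+n w₀ (s≤s z≤n))
  above (suc d) = subst P (sym (+-suc w₀ d))
    (subst (λ v → h (x ∷ xs) (suc (w₀ + d)) ≡ v [mod2^ e ]) (sym (hShift-∷ T x xs (w₀ + d)))
      (mod-+ (mod-*ˡ x (above d)) (xs≡ (suc (w₀ + d)) T≤w₀+d+1+j)))
    where
    reorder : ∀ a d j → a + suc j + d ≡ suc (a + d) + j
    reorder = ℕ-Solver.solve-∀
    T≤w₀+d+1+j : T ≤ suc (w₀ + d) + j
    T≤w₀+d+1+j = subst₂ _≤_ w₀+1+j≡T (reorder w₀ d j) (m≤m+n (w₀ + suc j) d)

-- Multiplying by an even entry gains a factor 2, which pays for the one degree it costs.
graded-∷-even : ∀ {N T xs β} y → β ≤ T → GradedShiftCongruent N T xs β →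
                GradedShiftCongruent N T (2 * y ∷ xs) β
graded-∷-even y β≤T xs≡ zero    _   w       _ = mod-0 _ _
graded-∷-even {T = T} y β≤T xs≡ (suc e) _ zero 1+e+T≤β =
  contradiction (subst (_≤ T) (+-comm (suc e) T) (≤-trans 1+e+T≤β β≤T)) (m+1+n≰m T)
graded-∷-even {T = T} {xs} y β≤T xs≡ (suc e) e<N (suc w) 1+e+T≤1+w+β =
  subst (λ v → h (2 * y ∷ xs) (suc w) ≡ v [mod2^ suc e ]) (sym (hShift-∷ T (2 * y) xs w))
    (mod-+ (mod-even-*ˡ y (graded-∷-even y β≤T xs≡ e (<⇒≤ e<N) w (s≤s⁻¹ 1+e+T≤1+w+β)))
           (xs≡ (suc e) e<N (suc w) 1+e+T≤1+w+β))

graded-evens++ : ∀ {N T xs β} E → β ≤ T → GradedShiftCongruent N T xs β →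
                 GradedShiftCongruent N T (evens E ++ xs) β
graded-evens++ zero    β≤T xs≡ = xs≡
graded-evens++ (suc E) β≤T xs≡ = graded-∷-even (suc E) β≤T (graded-evens++ E β≤T xs≡)

shiftCongruent⇒graded : ∀ {N T xs j} → ShiftCongruent N T xs j → GradedShiftCongruent N T xs (suc j)
shiftCongruent⇒graded xs≡ zero _ w _ = mod-0 _ _
shiftCongruent⇒graded {T = T} {j = j} xs≡ (suc e) e<N w 1+e+T≤w+1+j =
  mod-weaken e<N (xs≡ w (≤-trans (m≤n+m T e) (s≤s⁻¹ (subst (suc e + T ≤_) (+-suc w j) 1+e+T≤w+1+j))))

graded⇒periodic : ∀ {N T xs β} → GradedShiftCongruent N T xs β →
                  ∀ s → N ≤ s + β → h xs (s + T) ≡ h xs s [mod2^ N ]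
graded⇒periodic {N} {T} {xs} {β} xs≡ s N≤s+β =
  subst (λ v → h xs (s + T) ≡ v [mod2^ N ]) (trans (cong (hShift T xs) (+-comm s T)) (hShift-+ T xs s))
    (xs≡ N ≤-refl (s + T) (subst (N + T ≤_) (reorder s T β) (+-monoˡ-≤ T N≤s+β)))
  where
  reorder : ∀ s T β → s + β + T ≡ s + T + β
  reorder = ℕ-Solver.solve-∀

odds-shiftCongruent : ∀ {e T} q → q ≤ T → (∀ j → 1 ≤ j → j ≤ q → 2 ^ e ∣ h (odds j) (T ∸ j)) →
                      ShiftCongruent e T (odds q) q
odds-shiftCongruent {e} {T} zero    _   _       = shiftCongruent-[1] e T
odds-shiftCongruent         (suc q) q<T anchors =
  shiftCongruent-∷ q<T (anchors (suc q) (s≤s z≤n) ≤-refl)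
    (odds-shiftCongruent q (<⇒≤ q<T) (λ j 1≤j j≤q → anchors j 1≤j (m≤n⇒m≤1+n j≤q)))

sum< : ℕ → (ℕ → ℕ) → ℕ
sum< zero    f = 0
sum< (suc n) f = sum< n f + f n

syntax sum< n (λ t → e) = ∑[ t < n ] e

∑-cong : ∀ n {f g : ℕ → ℕ} → (∀ t → t < n → f t ≡ g t) → sum< n f ≡ sum< n g
∑-cong zero    eq = refl
∑-cong (suc n) eq = cong₂ _+_ (∑-cong n (λ t t<n → eq t (m<n⇒m<1+n t<n))) (eq n ≤-refl)

∑-zero : ∀ n (f : ℕ → ℕ) → (∀ t → t < n → f t ≡ 0) → sum< n f ≡ 0
∑-zero zero    f eq = refl
∑-zero (suc n) f eq = cong₂ _+_ (∑-zero n f (λ t t<n → eq t (m<n⇒m<1+n t<n))) (eq n ≤-refl)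

∑-distrib-+ : ∀ n (f g : ℕ → ℕ) → ∑[ t < n ] (f t + g t) ≡ sum< n f + sum< n g
∑-distrib-+ zero    f g = refl
∑-distrib-+ (suc n) f g =
  trans (cong (_+ (f n + g n)) (∑-distrib-+ n f g)) (+-+-interchange (sum< n f) (sum< n g) (f n) (g n))

*-distribˡ-∑ : ∀ n c (f : ℕ → ℕ) → c * sum< n f ≡ ∑[ t < n ] (c * f t)
*-distribˡ-∑ zero    c f = *-zeroʳ c
*-distribˡ-∑ (suc n) c f =
  trans (*-distribˡ-+ c (sum< n f) (f n)) (cong (_+ c * f n) (*-distribˡ-∑ n c f))

∑-head : ∀ n (f : ℕ → ℕ) → sum< (suc n) f ≡ f 0 + ∑[ t < n ] f (suc t)
∑-head zero    f = +-comm 0 (f 0)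
∑-head (suc n) f = trans (cong (_+ f (suc n)) (∑-head n f)) (+-assoc (f 0) _ _)

∑-∣ : ∀ {d} n (f : ℕ → ℕ) → (∀ t → t < n → d ∣ f t) → d ∣ sum< n f
∑-∣ zero    f d∣ = ℕ._∣0 _
∑-∣ (suc n) f d∣ = ℕ.∣m∣n⇒∣m+n (∑-∣ n f (λ t t<n → d∣ t (m<n⇒m<1+n t<n))) (d∣ n ≤-refl)

[k+1]*[n+1]C[k+1]≡[n+1]*nCk : ∀ n k → suc k * (suc n C suc k) ≡ suc n * (n C k)
[k+1]*[n+1]C[k+1]≡[n+1]*nCk zero    zero    = refl
[k+1]*[n+1]C[k+1]≡[n+1]*nCk zero    (suc k) = *-zeroʳ (2 + k)
[k+1]*[n+1]C[k+1]≡[n+1]*nCk (suc n) zero    =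
  trans (*-identityˡ _) (trans (nC1≡n (2 + n)) (sym (*-identityʳ (2 + n))))
[k+1]*[n+1]C[k+1]≡[n+1]*nCk (suc n) (suc k) = begin
  (2 + k) * ((2 + n) C (2 + k))
    ≡⟨ cong ((2 + k) *_) (pascal (1 + n) (1 + k)) ⟨
  (2 + k) * ((1 + n) C (1 + k) + (1 + n) C (2 + k))
    ≡⟨ expand k ((1 + n) C (1 + k)) _ ⟩
  (1 + k) * ((1 + n) C (1 + k)) + (1 + n) C (1 + k) + (2 + k) * ((1 + n) C (2 + k))
    ≡⟨ cong₂ (λ a b → a + (1 + n) C (1 + k) + b)
             ([k+1]*[n+1]C[k+1]≡[n+1]*nCk n k) ([k+1]*[n+1]C[k+1]≡[n+1]*nCk n (suc k)) ⟩
  (1 + n) * (n C k) + (1 + n) C (1 + k) + (1 + n) * (n C (1 + k))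
    ≡⟨ collect n (n C k) _ _ ⟩
  (1 + n) * (n C k + n C (1 + k)) + (1 + n) C (1 + k)
    ≡⟨ cong (λ c → (1 + n) * c + (1 + n) C (1 + k)) (pascal n k) ⟩
  (1 + n) * ((1 + n) C (1 + k)) + (1 + n) C (1 + k)
    ≡⟨ +-comm ((1 + n) * ((1 + n) C (1 + k))) _ ⟩
  (2 + n) * ((1 + n) C (1 + k))  ∎
  where
  open ≡-Reasoning
  pascal = nCk+nC[k+1]≡[n+1]C[k+1]
  expand : ∀ k a b → (2 + k) * (a + b) ≡ (1 + k) * a + a + (2 + k) * b
  expand = ℕ-Solver.solve-∀
  collect : ∀ n a c b → (1 + n) * a + c + (1 + n) * b ≡ (1 + n) * (a + b) + c
  collect = ℕ-Solver.solve-∀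

n∣[k+1]*nC[k+1] : ∀ n k → n ∣ suc k * (n C suc k)
n∣[k+1]*nC[k+1] zero    k = subst (0 ∣_) (sym (*-zeroʳ (suc k))) ℕ.∣-refl
n∣[k+1]*nC[k+1] (suc n) k =
  divides (n C k) (trans ([k+1]*[n+1]C[k+1]≡[n+1]*nCk n k) (*-comm (suc n) (n C k)))

2^m∣2^ν₂t*[2^m]Ct : ∀ m {t} → 1 ≤ t → 2 ^ m ∣ 2 ^ ν₂ t * (2 ^ m C t)
2^m∣2^ν₂t*[2^m]Ct m {suc k} 1≤t with odd-part 1≤t
... | u , t≡u*2^v , 2∤u = 2^e∣odd*n⇒2^e∣n m 2∤u (subst (2 ^ m ∣_) regroup (n∣[k+1]*nC[k+1] (2 ^ m) k))
  where
  regroup : suc k * (2 ^ m C suc k) ≡ u * (2 ^ ν₂ (suc k) * (2 ^ m C suc k))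
  regroup = trans (cong (_* (2 ^ m C suc k)) t≡u*2^v) (*-assoc u _ _)

∑-pascal : ∀ n (a : ℕ → ℕ) → ∑[ t < 2 + n ] (((1 + n) C t) * a t)
                             ≡ ∑[ t < 1 + n ] ((n C t) * a t) + ∑[ t < 1 + n ] ((n C t) * a (1 + t))
∑-pascal n a = begin
  ∑[ t < 2 + n ] (((1 + n) C t) * a t)
    ≡⟨ ∑-head (1 + n) _ ⟩
  a₀ + ∑[ t < 1 + n ] (((1 + n) C (1 + t)) * a (1 + t))
    ≡⟨ cong (_+_ a₀) (∑-cong (1 + n) split) ⟩
  a₀ + ∑[ t < 1 + n ] ((n C t) * a (1 + t) + (n C (1 + t)) * a (1 + t))
    ≡⟨ cong (_+_ a₀) (∑-distrib-+ (1 + n) _ _) ⟩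
  a₀ + (X + (∑[ t < n ] ((n C (1 + t)) * a (1 + t)) + (n C (1 + n)) * a (1 + n)))
    ≡⟨ cong (λ c → a₀ + (X + (∑[ t < n ] ((n C (1 + t)) * a (1 + t)) + c * a (1 + n))))
            (k>n⇒nCk≡0 (n<1+n n)) ⟩
  a₀ + (X + (∑[ t < n ] ((n C (1 + t)) * a (1 + t)) + 0))
    ≡⟨ swap-+ a₀ X _ ⟩
  a₀ + ∑[ t < n ] ((n C (1 + t)) * a (1 + t)) + X
    ≡⟨ cong (_+ X) (∑-head n _) ⟨
  ∑[ t < 1 + n ] ((n C t) * a t) + X  ∎
  where
  open ≡-Reasoning
  a₀ = 1 * a 0
  X = ∑[ t < 1 + n ] ((n C t) * a (1 + t))
  split : ∀ t → t < 1 + n → ((1 + n) C (1 + t)) * a (1 + t) ≡ (n C t) * a (1 + t) + (n C (1 + t)) * a (1 + t)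
  split t _ = trans (cong (_* a (1 + t)) (sym (nCk+nC[k+1]≡[n+1]C[k+1] n t))) (*-distribʳ-+ (a (1 + t)) (n C t) _)
  swap-+ : ∀ a b c → a + (b + (c + 0)) ≡ a + c + b
  swap-+ = ℕ-Solver.solve-∀

binomialStirling : ℕ → ℕ → ℕ
binomialStirling j n = ∑[ t < suc n ] ((n C t) * (2 ^ t * S t j))

binomialStirling-suc : ∀ i n → binomialStirling (suc i) (suc n)
                               ≡ suc (2 * suc i) * binomialStirling (suc i) n + 2 * binomialStirling i n
binomialStirling-suc i n = begin
  binomialStirling (suc i) (suc n)
    ≡⟨ ∑-pascal n (λ t → 2 ^ t * S t (suc i)) ⟩
  B₁ + ∑[ t < suc n ] ((n C t) * (2 ^ suc t * S (suc t) (suc i)))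
    ≡⟨ cong (B₁ +_) (∑-cong (suc n) (λ t _ → step (n C t) (2 ^ t) (suc i) (S t (suc i)) (S t i))) ⟩
  B₁ + ∑[ t < suc n ] (2 * suc i * ((n C t) * (2 ^ t * S t (suc i))) + 2 * ((n C t) * (2 ^ t * S t i)))
    ≡⟨ cong (B₁ +_) (∑-distrib-+ (suc n) _ _) ⟩
  B₁ + (∑[ t < suc n ] (2 * suc i * ((n C t) * (2 ^ t * S t (suc i))))
        + ∑[ t < suc n ] (2 * ((n C t) * (2 ^ t * S t i))))
    ≡⟨ cong (B₁ +_) (cong₂ _+_ (*-distribˡ-∑ (suc n) (2 * suc i) _) (*-distribˡ-∑ (suc n) 2 _)) ⟨
  B₁ + (2 * suc i * B₁ + 2 * binomialStirling i n)
    ≡⟨ +-assoc B₁ _ _ ⟨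
  suc (2 * suc i) * B₁ + 2 * binomialStirling i n  ∎
  where
  open ≡-Reasoning
  B₁ = binomialStirling (suc i) n
  step : ∀ c p j s s′ → c * (2 * p * (j * s + s′)) ≡ 2 * j * (c * (p * s)) + 2 * (c * (p * s′))
  step = ℕ-Solver.solve-∀

2^j*h[odds]≡binomialStirling : ∀ j s → 2 ^ j * h (odds j) s ≡ binomialStirling j (s + j)
2^j*h[odds]≡binomialStirling zero s = begin
  1 * h (1 ∷ []) s
    ≡⟨ trans (*-identityˡ _) (h-[1] s) ⟩
  1 + 0
    ≡⟨ cong (1 +_) (∑-zero (s + 0) _ (λ t _ → vanish t)) ⟨
  1 * (1 * 1) + ∑[ t < s + 0 ] (((s + 0) C suc t) * (2 ^ suc t * S (suc t) 0))
    ≡⟨ ∑-head (s + 0) _ ⟨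
  binomialStirling 0 (s + 0)  ∎
  where
  open ≡-Reasoning
  vanish : ∀ t → ((s + 0) C suc t) * (2 ^ suc t * 0) ≡ 0
  vanish t = trans (cong (((s + 0) C suc t) *_) (*-zeroʳ (2 ^ suc t))) (*-zeroʳ ((s + 0) C suc t))
2^j*h[odds]≡binomialStirling (suc i) zero = begin
  2 ^ suc i * 1
    ≡⟨ *-identityˡ _ ⟨
  0 + 1 * (2 ^ suc i * 1)
    ≡⟨ cong₂ (λ c s → 0 + c * (2 ^ suc i * s)) (nCn≡1 (suc i)) (S-diag (suc i)) ⟨
  0 + (suc i C suc i) * (2 ^ suc i * S (suc i) (suc i))
    ≡⟨ cong (_+ (suc i C suc i) * (2 ^ suc i * S (suc i) (suc i))) (∑-zero (suc i) _ below) ⟨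
  binomialStirling (suc i) (suc i)  ∎
  where
  open ≡-Reasoning
  below : ∀ t → t < suc i → (suc i C t) * (2 ^ t * S t (suc i)) ≡ 0
  below t t<j = begin
    (suc i C t) * (2 ^ t * S t (suc i)) ≡⟨ cong (λ c → (suc i C t) * (2 ^ t * c)) (S-< t<j) ⟩
    (suc i C t) * (2 ^ t * 0)           ≡⟨ cong ((suc i C t) *_) (*-zeroʳ (2 ^ t)) ⟩
    (suc i C t) * 0                     ≡⟨ *-zeroʳ (suc i C t) ⟩
    0                                   ∎
2^j*h[odds]≡binomialStirling (suc i) (suc s) = begin
  2 ^ suc i * (x * h (odds (suc i)) s + h (odds i) (suc s))
    ≡⟨ regroup (2 ^ i) x (h (odds (suc i)) s) (h (odds i) (suc s)) ⟩
  x * (2 ^ suc i * h (odds (suc i)) s) + 2 * (2 ^ i * h (odds i) (suc s))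
    ≡⟨ cong₂ (λ a b → x * a + 2 * b) (2^j*h[odds]≡binomialStirling (suc i) s)
             (trans (2^j*h[odds]≡binomialStirling i (suc s)) (cong (binomialStirling i) (sym (+-suc s i)))) ⟩
  x * binomialStirling (suc i) (s + suc i) + 2 * binomialStirling i (s + suc i)
    ≡⟨ binomialStirling-suc i (s + suc i) ⟨
  binomialStirling (suc i) (suc s + suc i)  ∎
  where
  open ≡-Reasoning
  x = suc (2 * suc i)
  regroup : ∀ p x a b → 2 * p * (x * a + b) ≡ x * (2 * p * a) + 2 * (p * b)
  regroup = ℕ-Solver.solve-∀

2^a+d≤2^[a+d] : ∀ a d → 2 ^ a + d ≤ 2 ^ (a + d)
2^a+d≤2^[a+d] a zero    = ≤-reflexive (trans (+-identityʳ (2 ^ a)) (cong (2 ^_) (sym (+-identityʳ a))))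
2^a+d≤2^[a+d] a (suc d) = begin
  2 ^ a + suc d     ≡⟨ +-suc (2 ^ a) d ⟩
  suc (2 ^ a + d)   ≤⟨ s≤s (2^a+d≤2^[a+d] a d) ⟩
  suc (2 ^ (a + d)) ≤⟨ n<2*n (m^n>0 2 (a + d)) ⟩
  2 ^ suc (a + d)   ≡⟨ cong (2 ^_) (+-suc a d) ⟨
  2 ^ (a + suc d)   ∎
  where open ≤-Reasoning

j+v≤B+t : ∀ {B j t v} → j < 2 ^ suc B → 2 ^ v ≤ t → j ≤ t → j + v ≤ B + t
j+v≤B+t {B} {j} {t} {v} j<2^[1+B] 2^v≤t j≤t with v ≤? B
... | yes v≤B = subst (j + v ≤_) (+-comm t B) (+-mono-≤ j≤t v≤B)
... | no  v≰B = subst (_≤ B + t) eq (+-monoʳ-≤ B 1+j+d≤t)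
  where
  d = v ∸ suc B
  1+B+d≡v : suc B + d ≡ v
  1+B+d≡v = m+[n∸m]≡n (≰⇒> v≰B)
  1+j+d≤t : suc j + d ≤ t
  1+j+d≤t = ≤-trans (+-monoˡ-≤ d j<2^[1+B])
              (≤-trans (2^a+d≤2^[a+d] (suc B) d) (subst (λ w → 2 ^ w ≤ t) (sym 1+B+d≡v) 2^v≤t))
  reorder : ∀ B j d → B + (suc j + d) ≡ j + (suc B + d)
  reorder = ℕ-Solver.solve-∀
  eq : B + (suc j + d) ≡ j + v
  eq = trans (reorder B j d) (cong (j +_) 1+B+d≡v)

2^[m∸B]∣h[odds] : ∀ {m B j} → B ≤ m → 1 ≤ j → j ≤ 2 ^ m → j < 2 ^ suc B →
                  2 ^ (m ∸ B) ∣ h (odds j) (2 ^ m ∸ j)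
2^[m∸B]∣h[odds] {m} {B} {j} B≤m 1≤j j≤2^m j<2^[1+B] = ℕ.*-cancelˡ-∣ (2 ^ j) {{m^n≢0 2 j}} (begin
  2 ^ j * 2 ^ N                    ≡⟨ *-comm (2 ^ j) (2 ^ N) ⟩
  2 ^ N * 2 ^ j                    ≡⟨ ^-distribˡ-+-* 2 N j ⟨
  2 ^ (N + j)                      ∣⟨ ∑-∣ (suc T) _ term ⟩
  binomialStirling j T             ≡⟨ cong (binomialStirling j) (m∸n+n≡m j≤2^m) ⟨
  binomialStirling j (T ∸ j + j)   ≡⟨ 2^j*h[odds]≡binomialStirling j (T ∸ j) ⟨
  2 ^ j * h (odds j) (T ∸ j)       ∎)
  where
  open ℕ.∣-Reasoning
  N = m ∸ B
  T = 2 ^ m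
  term : ∀ t → t < suc T → 2 ^ (N + j) ∣ (T C t) * (2 ^ t * S t j)
  term t _ with t <? j
  ... | yes t<j = subst (2 ^ (N + j) ∣_) (sym Ct*0≡0) (ℕ._∣0 _)
    where
    Ct*0≡0 : (T C t) * (2 ^ t * S t j) ≡ 0
    Ct*0≡0 = trans (cong (λ s → (T C t) * (2 ^ t * s)) (S-< t<j))
               (trans (cong ((T C t) *_) (*-zeroʳ (2 ^ t))) (*-zeroʳ (T C t)))
  ... | no  t≮j = begin
    2 ^ (N + j)                 ∣⟨ 2^[N+j]∣C*2^t ⟩
    (T C t) * 2 ^ t             ∣⟨ ℕ.m∣m*n (S t j) ⟩
    (T C t) * 2 ^ t * S t j     ≡⟨ *-assoc (T C t) (2 ^ t) (S t j) ⟩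
    (T C t) * (2 ^ t * S t j)   ∎
    where
    1≤t = ≤-trans 1≤j (≮⇒≥ t≮j)
    v = ν₂ t
    reorder : ∀ v N j → N + (j + v) ≡ v + (N + j)
    reorder = ℕ-Solver.solve-∀
    v+[N+j]≤m+t : v + (N + j) ≤ m + t
    v+[N+j]≤m+t = subst₂ _≤_ (reorder v N j) (trans (sym (+-assoc N B t)) (cong (_+ t) (m∸n+n≡m B≤m)))
      (+-monoʳ-≤ N (j+v≤B+t j<2^[1+B] (ℕ.∣⇒≤ {{>-nonZero 1≤t}} (2^ν₂∣ t)) (≮⇒≥ t≮j)))
    2^[N+j]∣C*2^t : 2 ^ (N + j) ∣ (T C t) * 2 ^ t
    2^[N+j]∣C*2^t = ℕ.*-cancelˡ-∣ (2 ^ v) {{m^n≢0 2 v}} (begin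
      2 ^ v * 2 ^ (N + j)         ≡⟨ ^-distribˡ-+-* 2 v (N + j) ⟨
      2 ^ (v + (N + j))           ∣⟨ 2^-mono-∣ v+[N+j]≤m+t ⟩
      2 ^ (m + t)                 ≡⟨ ^-distribˡ-+-* 2 m t ⟩
      2 ^ m * 2 ^ t               ∣⟨ ℕ.*-monoˡ-∣ (2 ^ t) (2^m∣2^ν₂t*[2^m]Ct m 1≤t) ⟩
      2 ^ v * (T C t) * 2 ^ t     ≡⟨ *-assoc (2 ^ v) (T C t) (2 ^ t) ⟩
      2 ^ v * ((T C t) * 2 ^ t)   ∎)

evens++odds-periodic : ∀ {m B} E q → B ≤ m → q < 2 ^ suc B → q < 2 ^ m →
                       ∀ s → m ∸ B ≤ s + suc q →
                       h (evens E ++ odds q) (s + 2 ^ m) ≡ h (evens E ++ odds q) s [mod2^ m ∸ B ]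
evens++odds-periodic {m} {B} E q B≤m q<2^[1+B] q<2^m = graded⇒periodic
  (graded-evens++ E q<2^m (shiftCongruent⇒graded (odds-shiftCongruent q (<⇒≤ q<2^m) anchors)))
  where
  anchors : ∀ j → 1 ≤ j → j ≤ q → 2 ^ (m ∸ B) ∣ h (odds j) (2 ^ m ∸ j)
  anchors j 1≤j j≤q =
    2^[m∸B]∣h[odds] B≤m 1≤j (≤-trans j≤q (<⇒≤ q<2^m)) (≤-<-trans j≤q q<2^[1+B])

fact≡! : ∀ n → fact n ≡ n !
fact≡! zero    = refl
fact≡! (suc n) = cong (suc n *_) (fact≡! n)

2^q∣[2q]! : ∀ q → 2 ^ q ∣ (2 * q) !
2^q∣[2q]! zero    = ℕ.1∣ 1
2^q∣[2q]! (suc q) = subst (λ n → 2 ^ suc q ∣ n !) (sym (*-suc 2 q))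
  (ℕ.*-pres-∣ (subst (2 ∣_) (*-suc 2 q) (ℕ.m∣m*n (suc q)))
              (ℕ.∣-trans (2^q∣[2q]! q) (ℕ.n∣m*n (suc (2 * q)))))

E≤ν₂[fact] : ∀ {E k} → E + E ≤ k → E ≤ ν₂ (fact k)
E≤ν₂[fact] {E} {k} E+E≤k = ν₂-maximal E (subst (1 ≤_) (sym (fact≡! k)) (1≤n! k))
  (subst (2 ^ E ∣_) (sym (fact≡! k))
    (ℕ.∣-trans (2^q∣[2q]! E) (ℕ.m≤n⇒m!∣n! (subst (_≤ k) (sym (2*n≡n+n E)) E+E≤k))))

q+1+q≤2n⇒q<n : ∀ {q n} → q + suc q ≤ 2 * n → q < n
q+1+q≤2n⇒q<n {q} {n} = *-cancelˡ-< 2 q n ∘ subst (_≤ 2 * n) (trans (+-suc q q) (cong suc (sym (2*n≡n+n q))))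

n≤2^⌈log₂n⌉ : ∀ n → n ≤ 2 ^ ⌈log₂ n ⌉
n≤2^⌈log₂n⌉ = <-rec _ bound
  where
  bound : ∀ n → (∀ {m} → m < n → m ≤ 2 ^ ⌈log₂ m ⌉) → n ≤ 2 ^ ⌈log₂ n ⌉
  bound 0                 _   = z≤n
  bound 1                 _   = s≤s z≤n
  bound n@(suc (suc n-2)) rec = begin
    n                                           ≡⟨ ⌊n/2⌋+⌈n/2⌉≡n n ⟨
    ⌊ n /2⌋ + ⌈ n /2⌉                           ≤⟨ +-monoˡ-≤ ⌈ n /2⌉ (⌊n/2⌋≤⌈n/2⌉ n) ⟩
    ⌈ n /2⌉ + ⌈ n /2⌉                           ≤⟨ +-mono-≤ half half ⟩
    2 ^ (⌈log₂ n ⌉ ∸ 1) + 2 ^ (⌈log₂ n ⌉ ∸ 1)   ≡⟨ 2*n≡n+n (2 ^ (⌈log₂ n ⌉ ∸ 1)) ⟨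
    2 ^ ⌈log₂ n ⌉                               ∎
    where
    open ≤-Reasoning
    half : ⌈ n /2⌉ ≤ 2 ^ (⌈log₂ n ⌉ ∸ 1)
    half = subst (λ e → ⌈ n /2⌉ ≤ 2 ^ e) (⌈log₂⌈n/2⌉⌉≡⌈log₂n⌉∸1 n) (rec (⌈n/2⌉<n n-2))

k≤2^[2+bk] : ∀ {k} → 4 ≤ k → k ≤ 2 ^ (2 + b k)
k≤2^[2+bk] {k} 4≤k = subst (λ e → k ≤ 2 ^ e) (sym 2+b≡⌈log₂k⌉) (n≤2^⌈log₂n⌉ k)
  where
  2≤⌈log₂k⌉ : 2 ≤ ⌈log₂ k ⌉
  2≤⌈log₂k⌉ = subst (_≤ ⌈log₂ k ⌉) (⌈log₂2^n⌉≡n 2) (⌈log₂⌉-mono-≤ 4≤k)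
  2+b≡⌈log₂k⌉ : 2 + b k ≡ ⌈log₂ k ⌉
  2+b≡⌈log₂k⌉ = trans (+-comm 2 (b k)) (m∸n+n≡m 2≤⌈log₂k⌉)

%-≡⇒≡+* : ∀ M {x y} → x ≤ y → x % suc M ≡ y % suc M → ∃[ d ] y ≡ x + d * suc M
%-≡⇒≡+* M {x} {y} x≤y x%≡y% = d , (begin
  y                                          ≡⟨ m≡m%n+[m/n]*n y (suc M) ⟩
  y % suc M + y / suc M * suc M              ≡⟨ cong₂ (λ r q → r + q * suc M) (sym x%≡y%) (sym y/≡x/+d) ⟩
  x % suc M + (x / suc M + d) * suc M        ≡⟨ regroup (x % suc M) (x / suc M) d (suc M) ⟩
  x % suc M + x / suc M * suc M + d * suc M  ≡⟨ cong (_+ d * suc M) (m≡m%n+[m/n]*n x (suc M)) ⟨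
  x + d * suc M                              ∎)
  where
  open ≡-Reasoning
  d = y / suc M ∸ x / suc M
  y/≡x/+d : x / suc M + d ≡ y / suc M
  y/≡x/+d = m+[n∸m]≡n (/-monoˡ-≤ (suc M) x≤y)
  regroup : ∀ r q d m → r + (q + d) * m ≡ r + q * m + d * m
  regroup = ℕ-Solver.solve-∀

module _ {k m B : ℕ} (1≤k : 1 ≤ k) (k≤2^[2+B] : k ≤ 2 ^ (2 + B)) (B≤m : B ≤ m)
         (N+ν₂≤T : (m ∸ B) + ν₂ (fact k) ≤ 2 ^ m) where

  S-periodic : ∀ {a} → k ≤ a → 2 ^ m ≤ a → S (a + 2 ^ m) k ≡ S a k [mod2^ m ∸ B ]
  S-periodic {a} k≤a T≤a with m ∸ B ≟ 0 | halves k 1≤k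
  ... | yes N≡0 | _ = subst (λ e → S (a + 2 ^ m) k ≡ S a k [mod2^ e ]) (sym N≡0) (mod-0 _ _)
  ... | no  N≢0 | E , q , k≡E+1+q , q≤E , E≤1+q , perm =
    subst₂ (λ u v → u ≡ v [mod2^ N ]) (as-S (s + T) a+T≡k+[s+T]) (as-S s (sym k+s≡a))
      (evens++odds-periodic E q B≤m q<2^[1+B] q<T s N≤s+1+q)
    where
    N = m ∸ B
    T = 2 ^ m
    s = a ∸ k
    k+s≡a : k + s ≡ a
    k+s≡a = m+[n∸m]≡n k≤a
    a+T≡k+[s+T] : a + T ≡ k + (s + T)
    a+T≡k+[s+T] = trans (cong (_+ T) (sym k+s≡a)) (+-assoc k s T)
    as-S : ∀ w {n} → n ≡ k + w → h (evens E ++ odds q) w ≡ S n k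
    as-S w refl = sym (trans (S-as-h k w) (h-↭ perm w))
    N+E≤T : N + E ≤ T
    N+E≤T = ≤-trans (+-monoʳ-≤ N (E≤ν₂[fact] (subst (E + E ≤_) (sym k≡E+1+q) (+-monoʳ-≤ E E≤1+q))))
                    N+ν₂≤T
    q<T : q < T
    q<T = ≤-trans (s≤s q≤E) (≤-trans (+-monoˡ-≤ E (n≢0⇒n>0 N≢0)) N+E≤T)
    q<2^[1+B] : q < 2 ^ suc B
    q<2^[1+B] = q+1+q≤2n⇒q<n
      (≤-trans (subst (q + suc q ≤_) (sym k≡E+1+q) (+-monoˡ-≤ (suc q) q≤E)) k≤2^[2+B])
    N≤s+1+q : N ≤ s + suc q
    N≤s+1+q = +-cancelˡ-≤ E N (s + suc q) (begin
      E + N             ≡⟨ +-comm E N ⟩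
      N + E             ≤⟨ N+E≤T ⟩
      T                 ≤⟨ T≤a ⟩
      a                 ≡⟨ k+s≡a ⟨
      k + s             ≡⟨ cong (_+ s) k≡E+1+q ⟩
      E + suc q + s     ≡⟨ +-assoc E (suc q) s ⟩
      E + (suc q + s)   ≡⟨ cong (E +_) (+-comm (suc q) s) ⟩
      E + (s + suc q)   ∎)
      where open ≤-Reasoning

  S-periodic-* : ∀ {a} d → k ≤ a → 2 ^ m ≤ a → S (a + d * 2 ^ m) k ≡ S a k [mod2^ m ∸ B ]
  S-periodic-* {a} zero    _   _   = mod-reflexive (cong (λ n → S n k) (+-identityʳ a))
  S-periodic-* {a} (suc d) k≤a T≤a =
    subst (λ n → S n k ≡ S a k [mod2^ m ∸ B ]) (regroup a d (2 ^ m))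
      (mod-trans (S-periodic (≤-trans k≤a (m≤m+n a _)) (≤-trans T≤a (m≤m+n a _)))
                 (S-periodic-* d k≤a T≤a))
    where
    regroup : ∀ a d t → a + d * t + t ≡ a + suc d * t
    regroup = ℕ-Solver.solve-∀

  S-≡mod-of-≡% : ∀ {u w} → u ≤ w → k ≤ u → 2 ^ m ≤ u →
                 u % suc (2 ^ m ∸ 1) ≡ w % suc (2 ^ m ∸ 1) → S w k ≡ S u k [mod2^ m ∸ B ]
  S-≡mod-of-≡% {u} u≤w k≤u T≤u u%≡w% with %-≡⇒≡+* (2 ^ m ∸ 1) u≤w u%≡w%
  ... | d , w≡u+d[1+[T∸1]] =
    subst (λ v → S v k ≡ S u k [mod2^ m ∸ B ])
      (sym (trans w≡u+d[1+[T∸1]] (cong (λ t → u + d * t) 1+[T∸1]≡T))) (S-periodic-* d k≤u T≤u)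
    where
    1+[T∸1]≡T : suc (2 ^ m ∸ 1) ≡ 2 ^ m
    1+[T∸1]≡T = trans (+-comm 1 _) (m∸n+n≡m (m^n>0 2 m))

  S-≡mod-on-class : ∀ {n x y} → k ≤ n → InClass n (2 ^ m) x → InClass n (2 ^ m) y →
                    S x k ≡ S y k [mod2^ m ∸ B ]
  S-≡mod-on-class {x = x} {y} k≤n (x≥n , x≥T , x%≡n%) (y≥n , y≥T , y%≡n%) with ≤-total x y
  ... | inj₁ x≤y = mod-sym (S-≡mod-of-≡% x≤y (≤-trans k≤n x≥n) x≥T (trans x%≡n% (sym y%≡n%)))
  ... | inj₂ y≤x = S-≡mod-of-≡% y≤x (≤-trans k≤n y≥n) y≥T (trans y%≡n% (sym x%≡n%))

proposition3p6 : (k m n : ℕ) → n ≥ k → k ≥ 5 → m ≥ b k →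
    2 ^ m ≥ (m ∸ b k) + ν₂ (fact k) →
    (Σ ℕ λ j₁ → Σ ℕ λ j₂ → InClass n (2 ^ m) j₁ × InClass n (2 ^ m) j₂ ×
       (ν₂ (S j₁ k) ≢ ν₂ (S j₂ k))) →
    (j : ℕ) → InClass n (2 ^ m) j → 2 ^ (m ∸ b k) ∣ S j k
proposition3p6 k m n k≤n 5≤k b≤m N+ν₂≤T (j₁ , j₂ , j₁∈ , j₂∈ , ν₂≢) j j∈@(j≥n , _) =
  decidable-stable (2 ^ (m ∸ b k) ℕ.∣? S j k) λ 2^N∤Sj →
    ν₂≢ (trans (ν₂-agrees 2^N∤Sj j₁∈) (sym (ν₂-agrees 2^N∤Sj j₂∈)))
  where
  1≤k : 1 ≤ k
  1≤k = ≤-trans (s≤s z≤n) 5≤k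
  ν₂-agrees : ¬ 2 ^ (m ∸ b k) ∣ S j k → ∀ {i} → InClass n (2 ^ m) i → ν₂ (S i k) ≡ ν₂ (S j k)
  ν₂-agrees 2^N∤Sj i∈@(i≥n , _) =
    ν₂-cong-≡mod (S-pos 1≤k (≤-trans k≤n i≥n)) (S-pos 1≤k (≤-trans k≤n j≥n)) 2^N∤Sj
      (S-≡mod-on-class 1≤k (k≤2^[2+bk] (≤-trans (n≤1+n 4) 5≤k)) b≤m N+ν₂≤T k≤n i∈ j∈)
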